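{- Let $G$ be a finite directed multigraph without loops on vertex set $\{1,\dots,n+1\}$ having a global sink at vertex $n+1$, with reduced Laplacian $\Delta$. Let $\mathbf a$ be a critical configuration and let $\mathbf b$ be a stable configuration linearly equivalent to $\mathbf a$. Then $w(\mathbf a)\ge w(\mathbf b)$, where $w(\mathbf x)=\sum_{i=1}^n x_i$.
   Context: $G=(V,E)$ is a directed multigraph without loops, $V=\{1,\dots,n+1\}$; $d^+_i$ is the out-degree of $i$ and $e_{i,j}$ the number of edges from $i$ to $j$. Vertex $n+1$ is a global sink: it has no out-going edges and every other vertex has a directed path to it. The reduced Laplacian $\Delta\in\mathbb Z^{n\times n}$ has $\Delta_{ii}=d^+_i$ and $\Delta_{ij}=-e_{i,j}$ for $i\ne j$ ($i,j\le n$); $\Delta_i$ is its $i$-th row. Vectors are row vectors. A configuration is a vector in $\mathbb Z^n$. Two configurations $\mathbf a,\mathbf b$ are linearly equivalent if $\mathbf b=\mathbf a-\sigma\Delta$ for some $\sigma\in\mathbb Z^n$. Vertex $i$ is active in $\mathbf a$ if $a_i\ge d^+_i$; firing it gives $\mathbf a-\Delta_i$. A firing sequence is legal if each fired vertex is active when it fires. A stable configuration is a non-negative configuration with no active vertex. For non-negative $\mathbf a$, $\mathbf a^\circ$ denotes the unique stable configuration reachable from $\mathbf a$ by a legal firing sequence. A non-negative configuration $\mathbf a$ is critical if for every configuration $\mathbf b$ there exists a non-negative configuration $\mathbf c$ with $\mathbf b+\mathbf c$ non-negative and $\mathbf a=(\mathbf b+\mathbf c)^\circ$. -}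

module Defs where

open import Data.Nat as ℕ using (ℕ; zero; suc)
open import Data.Integer as ℤ using (ℤ; +_; _-_; _*_; _≤_)
open import Data.Fin using (Fin; zero; suc; fromℕ; inject₁; _≟_)
open import Data.List using (List; []; _∷_)
open import Data.Product using (Σ; ∃; _×_; _,_)
open import Relation.Nullary using (¬_; yes; no)
open import Relation.Binary.PropositionalEquality using (_≡_)

sumℕ : ∀ {n} → (Fin n → ℕ) → ℕ
sumℕ {zero}  f = 0
sumℕ {suc n} f = f zero ℕ.+ sumℕ (λ i → f (suc i))

sumℤ : ∀ {n} → (Fin n → ℤ) → ℤ
sumℤ {zero}  f = + 0
sumℤ {suc n} f = f zero ℤ.+ sumℤ (λ i → f (suc i))

-- A directed multigraph on vertices Fin (suc n) (vertex "n+1" is  fromℕ n,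
-- vertices 1..n are  inject₁ i  for i : Fin n), given by edge multiplicities
-- e i j = number of edges from i to j.
Multigraph : ℕ → Set
Multigraph n = Fin (suc n) → Fin (suc n) → ℕ

sink : ∀ n → Fin (suc n)
sink n = fromℕ n

data Path {n} (e : Multigraph n) : Fin (suc n) → Fin (suc n) → Set where
  here : ∀ {i} → Path e i i
  step : ∀ {i j k} → ¬ (e i j ≡ 0) → Path e j k → Path e i k

record HasGlobalSink {n} (e : Multigraph n) : Set where
  field
    noLoops     : ∀ i → e i i ≡ 0
    sinkNoOut   : ∀ j → e (sink n) j ≡ 0
    reachesSink : ∀ i → Path e i (sink n)

outdeg : ∀ {n} → Multigraph n → Fin (suc n) → ℕ
outdeg e i = sumℕ (λ j → e i j)

d⁺ : ∀ {n} → Multigraph n → Fin n → ℕ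
d⁺ e i = outdeg e (inject₁ i)

Δ : ∀ {n} → Multigraph n → Fin n → Fin n → ℤ
Δ e i j with i ≟ j
... | yes _ = + d⁺ e i
... | no  _ = ℤ.- (+ e (inject₁ i) (inject₁ j))

Config : ℕ → Set
Config n = Fin n → ℤ

_·Δ[_] : ∀ {n} → Config n → Multigraph n → Config n
(σ ·Δ[ e ]) j = sumℤ (λ i → σ i * Δ e i j)

LinEquiv : ∀ {n} → Multigraph n → Config n → Config n → Set
LinEquiv {n} e a b = Σ (Config n) λ σ → ∀ j → b j ≡ a j - (σ ·Δ[ e ]) j

NonNeg : ∀ {n} → Config n → Set
NonNeg a = ∀ i → + 0 ≤ a i

Active : ∀ {n} → Multigraph n → Config n → Fin n → Set
Active e a i = + d⁺ e i ≤ a i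

fire : ∀ {n} → Multigraph n → Config n → Fin n → Config n
fire e a i j = a j - Δ e i j

Stable : ∀ {n} → Multigraph n → Config n → Set
Stable e a = NonNeg a × (∀ i → ¬ Active e a i)

data Legal {n} (e : Multigraph n) : Config n → List (Fin n) → Config n → Set where
  done : ∀ {a} → Legal e a [] a
  fires : ∀ {a i is b} → Active e a i → Legal e (fire e a i) is b
        → Legal e a (i ∷ is) b

IsStabilization : ∀ {n} → Multigraph n → Config n → Config n → Set
IsStabilization e x a = Stable e a × ∃ λ is → Legal e x is a

_+c_ : ∀ {n} → Config n → Config n → Config n
(b +c c) i = b i ℤ.+ c i

Critical : ∀ {n} → Multigraph n → Config n → Set
Critical {n} e a = NonNeg a × (∀ (b : Config n) → ∃ λ (c : Config n) →
  NonNeg c × NonNeg (b +c c) × IsStabilization e (b +c c) a)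

w : ∀ {n} → Config n → ℤ
w x = sumℤ x

-- By criticality a is reached from b + c, for some c ≥ 0, by legal firings; if u counts
-- them then a = b + c − uΔ, and b = a − σΔ. So v = u + σ satisfies vΔ = c ≥ 0, and any
-- such v is non-negative: its negative part v⁻ has v⁻Δ ≤ 0 entrywise, while the entries
-- of v⁻Δ sum to Σᵢ v⁻ᵢ e(i, sink) ≥ 0. So v⁻Δ = 0, which makes the support of v⁻ closed
-- under predecessors and free of edges into the sink; it is empty as every vertex reaches
-- the sink. Now b = (b + c) − vΔ has no active vertex, so by the least action principle
-- u ≤ v, i.e. σ ≥ 0, and w(b) = w(a) − Σᵢ σᵢ e(i, sink) ≤ w(a).
module Submission where

open import Data.Empty using (⊥-elim)
open import Data.Fin using (Fin; zero; suc; inject₁; _≟_)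
open import Data.Fin.Properties using (fromℕ≢inject₁)
open import Data.Fin.Relation.Unary.Top using (view; ‵fromℕ; ‵inject₁)
open import Data.Integer as ℤ using (ℤ; +_; _+_; _-_; -_; _*_; _≤_; _⊔_; +≤+)
import Data.Integer.Properties as ℤₚ
open import Data.Integer.Tactic.RingSolver using (solve-∀)
open import Data.List using (List; []; _∷_)
open import Data.Nat as ℕ using (ℕ; zero; suc; z≤n; s≤s)
import Data.Nat.Properties as ℕₚ
open import Data.Product using (_,_)
open import Data.Sum using (_⊎_; inj₁; inj₂)
open import Relation.Binary.PropositionalEquality
open import Relation.Nullary using (¬_; yes; no)

open import Defs

sumℕ-init-last : ∀ {n} (f : Fin (suc n) → ℕ) →
                 sumℕ f ≡ sumℕ (λ i → f (inject₁ i)) ℕ.+ f (sink n)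
sumℕ-init-last {zero}  f = ℕₚ.+-identityʳ (f zero)
sumℕ-init-last {suc n} f = begin
  f zero ℕ.+ sumℕ (λ i → f (suc i))
    ≡⟨ cong (f zero ℕ.+_) (sumℕ-init-last (λ i → f (suc i))) ⟩
  f zero ℕ.+ (sumℕ (λ i → f (suc (inject₁ i))) ℕ.+ f (sink (suc n)))
    ≡⟨ ℕₚ.+-assoc (f zero) _ _ ⟨
  f zero ℕ.+ sumℕ (λ i → f (suc (inject₁ i))) ℕ.+ f (sink (suc n)) ∎
  where open ≡-Reasoning

pos-sumℕ : ∀ {n} (f : Fin n → ℕ) → + sumℕ f ≡ sumℤ (λ i → + f i)
pos-sumℕ {zero}  f = refl
pos-sumℕ {suc n} f = trans (ℤₚ.pos-+ (f zero) _)
                           (cong (λ s → + f zero + s) (pos-sumℕ (λ i → f (suc i))))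

sumℤ-cong : ∀ {n} {f g : Fin n → ℤ} → (∀ i → f i ≡ g i) → sumℤ f ≡ sumℤ g
sumℤ-cong {zero}  f≗g = refl
sumℤ-cong {suc n} f≗g = cong₂ _+_ (f≗g zero) (sumℤ-cong (λ i → f≗g (suc i)))

sumℤ-zero : ∀ n → sumℤ {n} (λ _ → + 0) ≡ + 0
sumℤ-zero zero    = refl
sumℤ-zero (suc n) = trans (ℤₚ.+-identityˡ _) (sumℤ-zero n)

sumℤ-distrib-+ : ∀ {n} (f g : Fin n → ℤ) →
                 sumℤ (λ i → f i + g i) ≡ sumℤ f + sumℤ g
sumℤ-distrib-+ {zero}  f g = refl
sumℤ-distrib-+ {suc n} f g =
  trans (cong (_+_ (f zero + g zero)) (sumℤ-distrib-+ (λ i → f (suc i)) (λ i → g (suc i))))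
        (interchange (f zero) (g zero) _ _)
  where
  interchange : ∀ a b c d → (a + b) + (c + d) ≡ (a + c) + (b + d)
  interchange = solve-∀

sumℤ-neg : ∀ {n} (f : Fin n → ℤ) → sumℤ (λ i → - f i) ≡ - sumℤ f
sumℤ-neg {zero}  f = refl
sumℤ-neg {suc n} f = trans (cong (_+_ (- f zero)) (sumℤ-neg (λ i → f (suc i))))
                           (sym (ℤₚ.neg-distrib-+ (f zero) _))

sumℤ-distrib-minus : ∀ {n} (f g : Fin n → ℤ) →
                 sumℤ (λ i → f i - g i) ≡ sumℤ f - sumℤ g
sumℤ-distrib-minus f g =
  trans (sumℤ-distrib-+ f (λ i → - g i)) (cong (_+_ (sumℤ f)) (sumℤ-neg g))

sumℤ-distribˡ-* : ∀ {n} k (f : Fin n → ℤ) → sumℤ (λ i → k * f i) ≡ k * sumℤ f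
sumℤ-distribˡ-* {zero}  k f = sym (ℤₚ.*-zeroʳ k)
sumℤ-distribˡ-* {suc n} k f =
  trans (cong (_+_ (k * f zero)) (sumℤ-distribˡ-* k (λ i → f (suc i))))
        (sym (ℤₚ.*-distribˡ-+ k (f zero) _))

sumℤ-comm : ∀ {m n} (f : Fin m → Fin n → ℤ) →
            sumℤ (λ i → sumℤ (f i)) ≡ sumℤ (λ j → sumℤ (λ i → f i j))
sumℤ-comm {zero}  {n} f = sym (sumℤ-zero n)
sumℤ-comm {suc m}     f =
  trans (cong (_+_ (sumℤ (f zero))) (sumℤ-comm (λ i → f (suc i))))
        (sym (sumℤ-distrib-+ (f zero) (λ j → sumℤ (λ i → f (suc i) j))))

sumℤ-mono-≤ : ∀ {n} {f g : Fin n → ℤ} → (∀ i → f i ≤ g i) → sumℤ f ≤ sumℤ g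
sumℤ-mono-≤ {zero}  f≤g = ℤₚ.≤-refl
sumℤ-mono-≤ {suc n} f≤g = ℤₚ.+-mono-≤ (f≤g zero) (sumℤ-mono-≤ (λ i → f≤g (suc i)))

sumℤ-nonNeg : ∀ {n} {f : Fin n → ℤ} → (∀ i → + 0 ≤ f i) → + 0 ≤ sumℤ f
sumℤ-nonNeg {n} {f} 0≤f = subst (_≤ sumℤ f) (sumℤ-zero n) (sumℤ-mono-≤ 0≤f)

term≤sumℤ : ∀ {n} {f : Fin n → ℤ} → (∀ i → + 0 ≤ f i) → ∀ i → f i ≤ sumℤ f
term≤sumℤ {f = f} 0≤f zero    =
  ℤₚ.i≤i+j (f zero) _ {{ℤ.nonNegative (sumℤ-nonNeg (λ i → 0≤f (suc i)))}}
term≤sumℤ {f = f} 0≤f (suc i) =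
  ℤₚ.≤-trans (term≤sumℤ (λ i → 0≤f (suc i)) i)
             (ℤₚ.i≤j+i _ (f zero) {{ℤ.nonNegative (0≤f zero)}})

δ : ∀ {n} → Fin n → Fin n → ℤ
δ zero    zero    = + 1
δ zero    (suc _) = + 0
δ (suc _) zero    = + 0
δ (suc i) (suc j) = δ i j

δ-diag : ∀ {n} (i : Fin n) → δ i i ≡ + 1
δ-diag zero    = refl
δ-diag (suc i) = δ-diag i

δ-offDiag : ∀ {n} {i j : Fin n} → i ≢ j → δ i j ≡ + 0
δ-offDiag {i = zero}  {zero}  i≢j = ⊥-elim (i≢j refl)
δ-offDiag {i = zero}  {suc j} i≢j = refl
δ-offDiag {i = suc i} {zero}  i≢j = refl
δ-offDiag {i = suc i} {suc j} i≢j = δ-offDiag (λ i≡j → i≢j (cong suc i≡j))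

δ-sym : ∀ {n} (i j : Fin n) → δ i j ≡ δ j i
δ-sym zero    zero    = refl
δ-sym zero    (suc j) = refl
δ-sym (suc i) zero    = refl
δ-sym (suc i) (suc j) = δ-sym i j

sumℤ-δ-* : ∀ {n} (i : Fin n) (f : Fin n → ℤ) → sumℤ (λ k → δ i k * f k) ≡ f i
sumℤ-δ-* {suc n} zero    f = trans (cong (_+_ (+ 1 * f zero)) (sumℤ-zero n))
                                   (trans (ℤₚ.+-identityʳ _) (ℤₚ.*-identityˡ (f zero)))
sumℤ-δ-* {suc n} (suc i) f = trans (ℤₚ.+-identityˡ _) (sumℤ-δ-* i (λ k → f (suc k)))

firings : ∀ {n} → List (Fin n) → Config n
firings []       = λ _ → + 0
firings (i ∷ is) = δ i +c firings is

i≡j+[i-j] : ∀ i j → i ≡ j + (i - j)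
i≡j+[i-j] = solve-∀

[i+j]-i≡j : ∀ i j → (i + j) - i ≡ j
[i+j]-i≡j = solve-∀

[i-j]-k≡i-[j+k] : ∀ i j k → (i - j) - k ≡ i - (j + k)
[i-j]-k≡i-[j+k] = solve-∀

i≡j-k⇒k≡j-i : ∀ {i} j k → i ≡ j - k → k ≡ j - i
i≡j-k⇒k≡j-i j k refl = sym (j-[j-k]≡k j k)
  where
  j-[j-k]≡k : ∀ j k → j - (j - k) ≡ k
  j-[j-k]≡k = solve-∀

0≤i⇒i≡0∨1≤i : ∀ {i} → + 0 ≤ i → i ≡ + 0 ⊎ + 1 ≤ i
0≤i⇒i≡0∨1≤i (+≤+ {n = zero}  _) = inj₁ refl
0≤i⇒i≡0∨1≤i (+≤+ {n = suc _} _) = inj₂ (+≤+ (s≤s z≤n))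

i*n≤0⇒i≡0 : ∀ {i} n → + 0 ≤ i → i * + n ≤ + 0 → n ≢ 0 → i ≡ + 0
i*n≤0⇒i≡0 {+ zero}  _       _ _        _   = refl
i*n≤0⇒i≡0 {+ suc _} zero    _ _        n≢0 = ⊥-elim (n≢0 refl)
i*n≤0⇒i≡0 {+ suc _} (suc _) _ (+≤+ ()) _

module Laplacian {n} (e : Multigraph n) where

  E : Fin n → Fin n → ℕ
  E i j = e (inject₁ i) (inject₁ j)

  toSink : Fin n → ℕ
  toSink i = e (inject₁ i) (sink n)

  d⁺-split : ∀ i → d⁺ e i ≡ sumℕ (E i) ℕ.+ toSink i
  d⁺-split i = sumℕ-init-last (e (inject₁ i))

  ·Δ-cong : ∀ {u v : Config n} → (∀ i → u i ≡ v i) →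
            ∀ j → (u ·Δ[ e ]) j ≡ (v ·Δ[ e ]) j
  ·Δ-cong u≗v j = sumℤ-cong (λ i → cong (_* Δ e i j) (u≗v i))

  ·Δ-distrib-+ : ∀ (u v : Config n) j →
                 ((u +c v) ·Δ[ e ]) j ≡ (u ·Δ[ e ]) j + (v ·Δ[ e ]) j
  ·Δ-distrib-+ u v j = trans (sumℤ-cong (λ i → ℤₚ.*-distribʳ-+ (Δ e i j) (u i) (v i)))
                             (sumℤ-distrib-+ (λ i → u i * Δ e i j) (λ i → v i * Δ e i j))

  ·Δ-neg : ∀ (v : Config n) j → ((λ i → - v i) ·Δ[ e ]) j ≡ - (v ·Δ[ e ]) j
  ·Δ-neg v j = trans (sumℤ-cong (λ i → sym (ℤₚ.neg-distribˡ-* (v i) (Δ e i j))))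
                     (sumℤ-neg (λ i → v i * Δ e i j))

  δ·Δ : ∀ i j → (δ i ·Δ[ e ]) j ≡ Δ e i j
  δ·Δ i j = sumℤ-δ-* i (λ k → Δ e k j)

  legal⇒firings : ∀ {x is y} → Legal e x is y →
                  ∀ j → y j ≡ x j - (firings is ·Δ[ e ]) j
  legal⇒firings {x} done j = sym (begin
    x j - sumℤ {n} (λ _ → + 0) ≡⟨ cong (_-_ (x j)) (sumℤ-zero n) ⟩
    x j + + 0                  ≡⟨ ℤₚ.+-identityʳ (x j) ⟩
    x j                        ∎)
    where open ≡-Reasoning
  legal⇒firings {x} (fires {i = i} {is} _ legal) j = begin
    _                                         ≡⟨ legal⇒firings legal j ⟩
    (x j - Δ e i j) - uΔ                      ≡⟨ [i-j]-k≡i-[j+k] (x j) _ _ ⟩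
    x j - (Δ e i j + uΔ)                      ≡⟨ cong (λ d → x j - (d + uΔ)) (δ·Δ i j) ⟨
    x j - ((δ i ·Δ[ e ]) j + uΔ)              ≡⟨ cong (_-_ (x j)) (·Δ-distrib-+ (δ i) u j) ⟨
    x j - (firings (i ∷ is) ·Δ[ e ]) j        ∎
    where
    open ≡-Reasoning
    u : Config n
    u = firings is
    uΔ : ℤ
    uΔ = (u ·Δ[ e ]) j

  module _ (noLoops : ∀ i → e i i ≡ 0) where

    Δ≡δd⁺-E : ∀ i j → Δ e i j ≡ δ i j * + d⁺ e i - + E i j
    Δ≡δd⁺-E i j with i ≟ j
    ... | yes refl = begin
      + d⁺ e i                   ≡⟨ ℤₚ.*-identityˡ _ ⟨
      + 1 * + d⁺ e i             ≡⟨ ℤₚ.+-identityʳ _ ⟨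
      + 1 * + d⁺ e i - + 0       ≡⟨ cong₂ (λ d k → d * + d⁺ e i - + k)
                                          (δ-diag i) (noLoops (inject₁ i)) ⟨
      δ i i * + d⁺ e i - + E i i ∎
      where open ≡-Reasoning
    ... | no i≢j rewrite δ-offDiag i≢j = sym (ℤₚ.+-identityˡ _)

    ·Δ-column : ∀ (v : Config n) j →
                (v ·Δ[ e ]) j ≡ v j * + d⁺ e j - sumℤ (λ i → v i * + E i j)
    ·Δ-column v j = begin
      sumℤ (λ i → v i * Δ e i j)
        ≡⟨ sumℤ-cong (λ i → cong (v i *_) (Δ≡δd⁺-E i j)) ⟩
      sumℤ (λ i → v i * (δ i j * + d⁺ e i - + E i j))
        ≡⟨ sumℤ-cong (λ i → distribute (v i) (δ i j) (+ d⁺ e i) (+ E i j)) ⟩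
      sumℤ (λ i → δ i j * (v i * + d⁺ e i) - v i * + E i j)
        ≡⟨ sumℤ-distrib-minus (λ i → δ i j * (v i * + d⁺ e i)) (λ i → v i * + E i j) ⟩
      sumℤ (λ i → δ i j * (v i * + d⁺ e i)) - inflow
        ≡⟨ cong (_- inflow) (sumℤ-cong (λ i → cong (_* (v i * + d⁺ e i)) (δ-sym i j))) ⟩
      sumℤ (λ i → δ j i * (v i * + d⁺ e i)) - inflow
        ≡⟨ cong (_- inflow) (sumℤ-δ-* j (λ i → v i * + d⁺ e i)) ⟩
      v j * + d⁺ e j - inflow ∎
      where
      open ≡-Reasoning
      inflow : ℤ
      inflow = sumℤ (λ i → v i * + E i j)
      distribute : ∀ a b c d → a * (b * c - d) ≡ b * (a * c) - a * d
      distribute = solve-∀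

    ·Δ-antimono : ∀ {u v : Config n} j → (∀ i → u i ≤ v i) → u j ≡ v j →
                  (v ·Δ[ e ]) j ≤ (u ·Δ[ e ]) j
    ·Δ-antimono {u} {v} j u≤v uj≡vj = begin
      (v ·Δ[ e ]) j                     ≡⟨ ·Δ-column v j ⟩
      v j * + d⁺ e j - inflow v         ≤⟨ ℤₚ.+-monoʳ-≤ (v j * + d⁺ e j) (ℤₚ.neg-mono-≤ inflow-mono) ⟩
      v j * + d⁺ e j - inflow u         ≡⟨ cong (λ x → x * + d⁺ e j - inflow u) uj≡vj ⟨
      u j * + d⁺ e j - inflow u         ≡⟨ ·Δ-column u j ⟨
      (u ·Δ[ e ]) j                     ∎
      where
      open ℤₚ.≤-Reasoning
      inflow : Config n → ℤ
      inflow x = sumℤ (λ i → x i * + E i j)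
      inflow-mono : inflow u ≤ inflow v
      inflow-mono = sumℤ-mono-≤ (λ i → ℤₚ.*-monoʳ-≤-nonNeg (+ E i j) (u≤v i))

    ·Δ-nonPos-off-support : ∀ {v : Config n} j → NonNeg v → v j ≡ + 0 →
                            (v ·Δ[ e ]) j ≤ + 0
    ·Δ-nonPos-off-support {v} j v≥0 vj≡0 =
      subst ((v ·Δ[ e ]) j ≤_) (sumℤ-zero n) (·Δ-antimono j v≥0 (sym vj≡0))

    sumℤ-Δ-row : ∀ i → sumℤ (Δ e i) ≡ + toSink i
    sumℤ-Δ-row i = begin
      sumℤ (Δ e i)
        ≡⟨ sumℤ-cong (Δ≡δd⁺-E i) ⟩
      sumℤ (λ j → δ i j * + d⁺ e i - + E i j)
        ≡⟨ sumℤ-distrib-minus (λ j → δ i j * + d⁺ e i) (λ j → + E i j) ⟩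
      sumℤ (λ j → δ i j * + d⁺ e i) - sumℤ (λ j → + E i j)
        ≡⟨ cong₂ _-_ (sumℤ-δ-* i (λ _ → + d⁺ e i)) (sym (pos-sumℕ (E i))) ⟩
      + d⁺ e i - + sumℕ (E i)
        ≡⟨ cong (λ d → + d - + sumℕ (E i)) (d⁺-split i) ⟩
      + (sumℕ (E i) ℕ.+ toSink i) - + sumℕ (E i)
        ≡⟨ cong (_- + sumℕ (E i)) (ℤₚ.pos-+ (sumℕ (E i)) (toSink i)) ⟩
      (+ sumℕ (E i) + + toSink i) - + sumℕ (E i)
        ≡⟨ [i+j]-i≡j (+ sumℕ (E i)) (+ toSink i) ⟩
      + toSink i ∎
      where open ≡-Reasoning

    w-·Δ : ∀ (v : Config n) → w (v ·Δ[ e ]) ≡ sumℤ (λ i → v i * + toSink i)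
    w-·Δ v = begin
      sumℤ (λ j → sumℤ (λ i → v i * Δ e i j))
        ≡⟨ sumℤ-comm (λ i j → v i * Δ e i j) ⟨
      sumℤ (λ i → sumℤ (λ j → v i * Δ e i j))
        ≡⟨ sumℤ-cong (λ i → sumℤ-distribˡ-* (v i) (Δ e i)) ⟩
      sumℤ (λ i → v i * sumℤ (Δ e i))
        ≡⟨ sumℤ-cong (λ i → cong (v i *_) (sumℤ-Δ-row i)) ⟩
      sumℤ (λ i → v i * + toSink i) ∎
      where open ≡-Reasoning

    w-·Δ-nonNeg : ∀ {σ : Config n} → NonNeg σ → + 0 ≤ w (σ ·Δ[ e ])
    w-·Δ-nonNeg {σ} σ≥0 = subst (+ 0 ≤_) (sym (w-·Δ σ))
      (sumℤ-nonNeg (λ i → ℤₚ.*-monoʳ-≤-nonNeg (+ toSink i) (σ≥0 i)))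

    w[a-σΔ]≤w[a] : ∀ {a b σ : Config n} → NonNeg σ →
                   (∀ j → b j ≡ a j - (σ ·Δ[ e ]) j) → w b ≤ w a
    w[a-σΔ]≤w[a] {a} {b} {σ} σ≥0 b≡a-σΔ =
      subst (_≤ w a) (sym (trans (sumℤ-cong b≡a-σΔ) (sumℤ-distrib-minus a (σ ·Δ[ e ]))))
            (ℤₚ.i-j≤i (w a) (w (σ ·Δ[ e ])) {{ℤ.nonNegative (w-·Δ-nonNeg σ≥0)}})

    least-action : ∀ {x is y} → Legal e x is y → (v z : Config n) → NonNeg v →
                   (∀ j → z j ≡ x j - (v ·Δ[ e ]) j) → (∀ j → ¬ Active e z j) →
                   ∀ k → firings is k ≤ v k
    least-action done v z v≥0 z≡x-vΔ z-inactive k = v≥0 k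
    least-action {x} (fires {i = i} {is} i-active legal) v z v≥0 z≡x-vΔ z-inactive k
      with 0≤i⇒i≡0∨1≤i (v≥0 i)
    ... | inj₁ vi≡0 = ⊥-elim (z-inactive i (ℤₚ.≤-trans i-active xi≤zi))
      where
      -- i is not fired along v, so it only receives chips
      xi≤zi : x i ≤ z i
      xi≤zi = subst (x i ≤_) (sym (z≡x-vΔ i))
        (ℤₚ.i≤i+j (x i) _
          {{ℤ.nonNegative (ℤₚ.neg-mono-≤ (·Δ-nonPos-off-support i v≥0 vi≡0))}})
    ... | inj₂ 1≤vi = subst (_ ≤_) (sym (i≡j+[i-j] (v k) (δ i k)))
      (ℤₚ.+-monoʳ-≤ (δ i k) (least-action legal v′ z v′≥0 z≡x′-v′Δ z-inactive k))
      where
      v′ : Config n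
      v′ k = v k - δ i k

      v′≥0 : NonNeg v′
      v′≥0 k with i ≟ k
      ... | yes refl rewrite δ-diag i    = ℤₚ.i≤j⇒0≤j-i 1≤vi
      ... | no i≢k   rewrite δ-offDiag i≢k =
        subst (+ 0 ≤_) (sym (ℤₚ.+-identityʳ (v k))) (v≥0 k)

      z≡x′-v′Δ : ∀ j → z j ≡ fire e x i j - (v′ ·Δ[ e ]) j
      z≡x′-v′Δ j = begin
        z j                            ≡⟨ z≡x-vΔ j ⟩
        x j - (v ·Δ[ e ]) j            ≡⟨ cong (_-_ (x j)) (·Δ-cong v≡δ+v′ j) ⟩
        x j - ((δ i +c v′) ·Δ[ e ]) j  ≡⟨ cong (_-_ (x j)) (·Δ-distrib-+ (δ i) v′ j) ⟩
        x j - ((δ i ·Δ[ e ]) j + v′Δ)  ≡⟨ cong (λ d → x j - (d + v′Δ)) (δ·Δ i j) ⟩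
        x j - (Δ e i j + v′Δ)          ≡⟨ [i-j]-k≡i-[j+k] (x j) (Δ e i j) v′Δ ⟨
        (x j - Δ e i j) - v′Δ          ∎
        where
        open ≡-Reasoning
        v′Δ : ℤ
        v′Δ = (v′ ·Δ[ e ]) j
        v≡δ+v′ : ∀ k → v k ≡ δ i k + v′ k
        v≡δ+v′ k = i≡j+[i-j] (v k) (δ i k)

    module _ (reachesSink : ∀ k → Path e k (sink n)) (v : Config n)
             (vΔ≥0 : ∀ j → + 0 ≤ (v ·Δ[ e ]) j) where

      private
        v⁻ : Config n
        v⁻ i = - v i ⊔ + 0

        v⁻≥0 : NonNeg v⁻
        v⁻≥0 i = ℤₚ.i≤j⊔i (- v i) (+ 0)

        v⁻Δ≤0 : ∀ j → (v⁻ ·Δ[ e ]) j ≤ + 0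
        v⁻Δ≤0 j with ℤₚ.⊔-sel (- v j) (+ 0)
        ... | inj₁ v⁻j≡-vj =
          ℤₚ.≤-trans (·Δ-antimono j (λ i → ℤₚ.i≤i⊔j (- v i) (+ 0)) (sym v⁻j≡-vj))
                     (subst (_≤ + 0) (sym (·Δ-neg v j)) (ℤₚ.neg-mono-≤ (vΔ≥0 j)))
        ... | inj₂ v⁻j≡0   = ·Δ-nonPos-off-support j v⁻≥0 v⁻j≡0

        v⁻Δ≥0 : ∀ j → + 0 ≤ (v⁻ ·Δ[ e ]) j
        v⁻Δ≥0 j = ℤₚ.neg-cancel-≤ (ℤₚ.≤-trans
          (term≤sumℤ (λ k → ℤₚ.neg-mono-≤ (v⁻Δ≤0 k)) j)
          (subst (_≤ + 0) (sym (sumℤ-neg (v⁻ ·Δ[ e ]))) (ℤₚ.neg-mono-≤ (w-·Δ-nonNeg v⁻≥0))))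

        v⁻-vanishes-near-sink : ∀ i → toSink i ≢ 0 → v⁻ i ≡ + 0
        v⁻-vanishes-near-sink i toSink≢0 = i*n≤0⇒i≡0 (toSink i) (v⁻≥0 i)
          (ℤₚ.≤-trans (term≤sumℤ (λ k → ℤₚ.*-monoʳ-≤-nonNeg (+ toSink k) (v⁻≥0 k)) i)
                      (subst (_≤ + 0) (w-·Δ v⁻) wv⁻Δ≤0))
          toSink≢0
          where
          wv⁻Δ≤0 : w (v⁻ ·Δ[ e ]) ≤ + 0
          wv⁻Δ≤0 = subst (w (v⁻ ·Δ[ e ]) ≤_) (sumℤ-zero n) (sumℤ-mono-≤ v⁻Δ≤0)

        v⁻-vanishes-backwards : ∀ i j → E i j ≢ 0 → v⁻ j ≡ + 0 → v⁻ i ≡ + 0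
        v⁻-vanishes-backwards i j Eij≢0 v⁻j≡0 = i*n≤0⇒i≡0 (E i j) (v⁻≥0 i)
          (ℤₚ.≤-trans (term≤sumℤ (λ k → ℤₚ.*-monoʳ-≤-nonNeg (+ E k j) (v⁻≥0 k)) i)
                      (ℤₚ.neg-cancel-≤ (subst (+ 0 ≤_) v⁻Δj≡-inflow (v⁻Δ≥0 j))))
          Eij≢0
          where
          inflow : ℤ
          inflow = sumℤ (λ k → v⁻ k * + E k j)
          v⁻Δj≡-inflow : (v⁻ ·Δ[ e ]) j ≡ - inflow
          v⁻Δj≡-inflow = trans (·Δ-column v⁻ j)
            (trans (cong (λ r → r * + d⁺ e j - inflow) v⁻j≡0) (ℤₚ.+-identityˡ _))

        v⁻-vanishes : ∀ {k} → Path e k (sink n) → ∀ i → k ≡ inject₁ i → v⁻ i ≡ + 0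
        v⁻-vanishes here i k≡i = ⊥-elim (fromℕ≢inject₁ k≡i)
        v⁻-vanishes (step {j = k′} Eik′≢0 path) i refl with view k′
        ... | ‵fromℕ     = v⁻-vanishes-near-sink i Eik′≢0
        ... | ‵inject₁ j = v⁻-vanishes-backwards i j Eik′≢0 (v⁻-vanishes path j refl)

      ·Δ-nonNeg⇒nonNeg : NonNeg v
      ·Δ-nonNeg⇒nonNeg i = ℤₚ.neg-cancel-≤
        (subst (- v i ≤_) (v⁻-vanishes (reachesSink (inject₁ i)) i refl)
               (ℤₚ.i≤i⊔j (- v i) (+ 0)))

    unfiring-vector-nonNeg : ∀ {a b c : Config n} {is σ} → (∀ k → Path e k (sink n)) →
                             NonNeg c → (∀ j → ¬ Active e b j) → Legal e (b +c c) is a →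
                             (∀ j → b j ≡ a j - (σ ·Δ[ e ]) j) → NonNeg σ
    unfiring-vector-nonNeg {a} {b} {c} {is} {σ} reachesSink c≥0 b-inactive legal b≡a-σΔ k =
      subst (+ 0 ≤_) ([i+j]-i≡j (u k) (σ k)) (ℤₚ.i≤j⇒0≤j-i (u≤v k))
      where
      u v : Config n
      u = firings is
      v = u +c σ

      vΔ≡c : ∀ j → (v ·Δ[ e ]) j ≡ c j
      vΔ≡c j = begin
        (v ·Δ[ e ]) j                      ≡⟨ ·Δ-distrib-+ u σ j ⟩
        (u ·Δ[ e ]) j + (σ ·Δ[ e ]) j      ≡⟨ cong₂ _+_ uΔ≡b+c-a σΔ≡a-b ⟩
        ((b j + c j) - a j) + (a j - b j)  ≡⟨ telescope (b j) (c j) (a j) ⟩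
        c j                                ∎
        where
        open ≡-Reasoning
        uΔ≡b+c-a : (u ·Δ[ e ]) j ≡ (b j + c j) - a j
        uΔ≡b+c-a = i≡j-k⇒k≡j-i (b j + c j) _ (legal⇒firings legal j)
        σΔ≡a-b : (σ ·Δ[ e ]) j ≡ a j - b j
        σΔ≡a-b = i≡j-k⇒k≡j-i (a j) _ (b≡a-σΔ j)
        telescope : ∀ x y z → ((x + y) - z) + (z - x) ≡ y
        telescope = solve-∀

      v≥0 : NonNeg v
      v≥0 = ·Δ-nonNeg⇒nonNeg reachesSink v (λ j → subst (+ 0 ≤_) (sym (vΔ≡c j)) (c≥0 j))

      b≡b+c-vΔ : ∀ j → b j ≡ (b j + c j) - (v ·Δ[ e ]) j
      b≡b+c-vΔ j = i≡j-k⇒k≡j-i (b j + c j) _ (trans (vΔ≡c j) (sym ([i+j]-i≡j (b j) (c j))))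

      u≤v : ∀ k → u k ≤ v k
      u≤v = least-action legal v b v≥0 b≡b+c-vΔ b-inactive

theorem1 : (n : ℕ) (e : Multigraph n) → HasGlobalSink e →
    (a b : Config n) → Critical e a → Stable e b → LinEquiv e a b →
    w b ≤ w a
theorem1 n e G a b (_ , critical) (_ , b-inactive) (σ , b≡a-σΔ) with critical b
... | c , c≥0 , _ , _ , _ , legal = w[a-σΔ]≤w[a] noLoops σ≥0 b≡a-σΔ
  where
  open HasGlobalSink G
  open Laplacian e
  σ≥0 : NonNeg σ
  σ≥0 = unfiring-vector-nonNeg noLoops reachesSink c≥0 b-inactive legal b≡a-σΔ
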